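{- Let $r\ge 0$ and $s>r+1$ be integers, let $a_0,a_1,\dots,a_s\ge 0$ be integers, and let $N=a_0+a_1+\dots+a_s$. Let $u=(u_1,\dots,u_N)$ be the list consisting of $a_0$ entries equal to $1$, followed by $a_1$ entries equal to $q$, followed by $a_2$ entries equal to $q^2$, ..., followed by $a_s$ entries equal to $q^s$. Let $v=(v_1,\dots,v_N)$ be the list consisting of $a_0$ entries equal to $1$, followed by $a_1$ entries equal to $q$, ..., followed by $a_r$ entries equal to $q^r$, followed by $a_{r+1}+a_{r+2}+\dots+a_s$ entries equal to $q^{r+1}$. Then the coefficients of $q^0,q^1,\dots,q^r$ in the polynomial $$P_N(q;u_1,\dots,u_N)-P_N(q;v_1,\dots,v_N)$$ all vanish.
   Context: For a permutation $\pi=\pi_1\cdots\pi_n$ of $\{1,\dots,n\}$ and a pattern $\sigma\in S_k$, let $N_\sigma(\pi)$ be the number of index tuples $1\le i_1<\dots<i_k\le n$ such that $\pi_{i_1},\dots,\pi_{i_k}$ are in the same relative order as $\sigma_1,\dots,\sigma_k$. For $\pi\in S_n$ define $$\mathrm{weight}(\pi)=q^{N_{[1,2,3]}(\pi)}\prod_{i=1}^n x_i^{|\{1\le a<b\le n:\ \pi_a=i<\pi_b\}|},$$ and $P_n(q;x_1,\dots,x_n)=\sum_{\pi\in S_n}\mathrm{weight}(\pi)$, a polynomial in $q,x_1,\dots,x_n$; $P_n(q;u_1,\dots,u_n)$ denotes its value after substituting $x_j=u_j$. -}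

module Defs where

open import Data.Bool using (Bool; true; false; _∧_; if_then_else_)
open import Data.Nat as ℕ using (ℕ; zero; suc; _∸_; _<ᵇ_; _≡ᵇ_)
open import Data.Integer as ℤ using (ℤ; 0ℤ; 1ℤ)
open import Data.List using (List; []; _∷_; length; map; foldr; filterᵇ; upTo; concat; concatMap; replicate; lookup; allFin)
open import Data.Fin using (Fin; toℕ)

-- Formal power series in one variable q with integer coefficients,
-- represented by their coefficient functions (coefficient of q^k).

Poly : Set
Poly = ℕ → ℤ

coeff : Poly → ℕ → ℤ
coeff p k = p k

pconst : ℤ → Poly
pconst c zero    = c
pconst c (suc _) = 0ℤ

p0 p1 : Poly
p0 = pconst 0ℤ
p1 = pconst 1ℤ

pq : Poly
pq (suc zero) = 1ℤ
pq _          = 0ℤ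

_⊕_ : Poly → Poly → Poly
(p ⊕ r) k = p k ℤ.+ r k

_⊖_ : Poly → Poly → Poly
(p ⊖ r) k = p k ℤ.- r k

_⊗_ : Poly → Poly → Poly
(p ⊗ r) k = foldr ℤ._+_ 0ℤ (map (λ j → p j ℤ.* r (k ∸ j)) (upTo (suc k)))

_^ᵖ_ : Poly → ℕ → Poly
p ^ᵖ zero  = p1
p ^ᵖ suc n = p ⊗ (p ^ᵖ n)

psum : List Poly → Poly
psum = foldr _⊕_ p0

pprod : List Poly → Poly
pprod = foldr _⊗_ p1

-- Permutations of {1,…,n}, as words π₁⋯πₙ (lists of naturals).

words : ℕ → ℕ → List (List ℕ)
words n zero    = [] ∷ []
words n (suc m) = concatMap (λ w → map (λ i → suc i ∷ w) (upTo n)) (words n m)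

notElem : ℕ → List ℕ → Bool
notElem x []       = true
notElem x (y ∷ ys) = if x ≡ᵇ y then false else notElem x ys

distinct : List ℕ → Bool
distinct []       = true
distinct (x ∷ xs) = notElem x xs ∧ distinct xs

perms : ℕ → List (List ℕ)
perms n = filterᵇ distinct (words n n)

subseqs : {A : Set} → List A → List (List A)
subseqs []       = [] ∷ []
subseqs (x ∷ xs) = map (x ∷_) (subseqs xs) Data.List.++ subseqs xs

count : {A : Set} → (A → Bool) → List A → ℕ
count p xs = length (filterᵇ p xs)

-- x is compared against each element of ys the same way σ-head vs σ-tail
sameCmp : ℕ → List ℕ → ℕ → List ℕ → Bool
sameCmp x []       y []       = true
sameCmp x (a ∷ as) y (b ∷ bs) =
  (if (x ℕ.<ᵇ a) then (y ℕ.<ᵇ b) else (if (y ℕ.<ᵇ b) then false else true))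
  ∧ sameCmp x as y bs
sameCmp x _ y _ = false

sameOrder : List ℕ → List ℕ → Bool
sameOrder []       []       = true
sameOrder (x ∷ xs) (y ∷ ys) = sameCmp x xs y ys ∧ sameOrder xs ys
sameOrder _        _        = false

patCount : List ℕ → List ℕ → ℕ
patCount σ π = count (λ w → sameOrder w σ) (subseqs π)

cnt : ℕ → List ℕ → ℕ
cnt i π = count ok (subseqs π)
  where
  ok : List ℕ → Bool
  ok (x ∷ y ∷ []) = (x ≡ᵇ i) ∧ (i ℕ.<ᵇ y)
  ok _            = false

-- P_n(q; u₁,…,uₙ) with n = length us and x_j := u_j.

weightAt : (us : List Poly) → List ℕ → Poly
weightAt us π =
  (pq ^ᵖ patCount (1 ∷ 2 ∷ 3 ∷ []) π)
  ⊗ pprod (map (λ j → lookup us j ^ᵖ cnt (suc (toℕ j)) π) (allFin (length us)))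

P : List Poly → Poly
P us = psum (map (weightAt us) (perms (length us)))

uList : (s : ℕ) → (Fin (suc s) → ℕ) → List Poly
uList s a = concat (map (λ j → replicate (a j) (pq ^ᵖ toℕ j)) (allFin (suc s)))

vList : (r s : ℕ) → (Fin (suc s) → ℕ) → List Poly
vList r s a = concat (map (λ j → replicate (a j) (pq ^ᵖ ℕ._⊓_ (toℕ j) (suc r))) (allFin (suc s)))

-- The lists u and v agree entrywise modulo q^(r+1): entries q^j with j ≤ r are equal, and the
-- remaining entries q^j (j > r) and q^(r+1) are both ≡ 0. Since P_N is a polynomial in q and
-- the x_j, and agreement of the coefficients of q^0, …, q^r is a congruence for +, · and
-- powers, P_N(q; u) and P_N(q; v) agree in these coefficients.
module Submission where

open import Defs
open import Data.Nat using (ℕ; suc; _+_; _<_; _≤_)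
open import Data.Fin using (Fin)
open import Data.Integer using (0ℤ)
open import Relation.Binary.PropositionalEquality using (_≡_)

open import Data.Fin using (toℕ)
open import Data.Nat using (zero; s≤s; _∸_; _⊓_; _≤?_)
open import Data.Nat.Properties using (≤-trans; <-trans; ≤-<-trans; ≤-pred; m∸n≤m; n<1+n; ≰⇒>; m≤n⇒m⊓n≡m; m≥n⇒m⊓n≡n; <⇒≤)
open import Data.Integer as ℤ using (ℤ)
open import Data.Integer.Properties using (i≡j⇒i-j≡0; *-identityˡ)
open import Data.List using (List; []; _∷_; map; foldr; upTo; length; lookup; tabulate; allFin)
open import Data.List.Properties using (map-cong-local; map-tabulate)
open import Data.List.Relation.Unary.All.Properties using (applyUpTo⁺₁)
open import Data.List.Relation.Binary.Pointwise as Pointwise using (Pointwise; []; _∷_; Pointwise-length)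
open import Relation.Nullary using (yes; no)
open import Relation.Binary.PropositionalEquality using (refl; sym; trans; cong; cong₂; subst; subst₂)

sumUpTo : ℕ → (ℕ → ℤ) → ℤ
sumUpTo n f = foldr ℤ._+_ 0ℤ (map f (upTo n))

sumUpTo-cong : ∀ n {f g : ℕ → ℤ} → (∀ i → i < n → f i ≡ g i) → sumUpTo n f ≡ sumUpTo n g
sumUpTo-cong n f≡g = cong (foldr ℤ._+_ 0ℤ) (map-cong-local (applyUpTo⁺₁ (λ i → i) n (f≡g _)))

sum-zeros : ∀ (xs : List ℕ) → foldr ℤ._+_ 0ℤ (map (λ _ → 0ℤ) xs) ≡ 0ℤ
sum-zeros []       = refl
sum-zeros (_ ∷ xs) = cong (ℤ._+_ 0ℤ) (sum-zeros xs)

sumUpTo-zero : ∀ n {f : ℕ → ℤ} → (∀ i → i < n → f i ≡ 0ℤ) → sumUpTo n f ≡ 0ℤ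
sumUpTo-zero n f≡0 = trans (sumUpTo-cong n f≡0) (sum-zeros (upTo n))

_≈[_]_ : Poly → ℕ → Poly → Set
p ≈[ r ] p′ = ∀ k → k ≤ r → p k ≡ p′ k

≈-refl : ∀ {r} p → p ≈[ r ] p
≈-refl p _ _ = refl

⊕-cong : ∀ {r p p′ x x′} → p ≈[ r ] p′ → x ≈[ r ] x′ → (p ⊕ x) ≈[ r ] (p′ ⊕ x′)
⊕-cong p≈p′ x≈x′ k k≤r = cong₂ ℤ._+_ (p≈p′ k k≤r) (x≈x′ k k≤r)

⊗-cong : ∀ {r p p′ x x′} → p ≈[ r ] p′ → x ≈[ r ] x′ → (p ⊗ x) ≈[ r ] (p′ ⊗ x′)
⊗-cong p≈p′ x≈x′ k k≤r = sumUpTo-cong (suc k) λ i i≤k →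
  cong₂ ℤ._*_ (p≈p′ i (≤-trans (≤-pred i≤k) k≤r)) (x≈x′ (k ∸ i) (≤-trans (m∸n≤m k i) k≤r))

^ᵖ-cong : ∀ {r x y} c → x ≈[ r ] y → (x ^ᵖ c) ≈[ r ] (y ^ᵖ c)
^ᵖ-cong zero    x≈y = ≈-refl p1
^ᵖ-cong (suc c) x≈y = ⊗-cong x≈y (^ᵖ-cong c x≈y)

psum-cong : ∀ {r ps qs} → Pointwise _≈[ r ]_ ps qs → psum ps ≈[ r ] psum qs
psum-cong = Pointwise.foldr⁺ ⊕-cong (≈-refl p0)

pprod-cong : ∀ {r ps qs} → Pointwise _≈[ r ]_ ps qs → pprod ps ≈[ r ] pprod qs
pprod-cong = Pointwise.foldr⁺ ⊗-cong (≈-refl p1)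

pq^-coeff-< : ∀ m k → k < m → (pq ^ᵖ m) k ≡ 0ℤ
pq^-coeff-< (suc m) k k<1+m = sumUpTo-zero (suc k) (term k k<1+m)
  where
  -- pq i vanishes unless i = 1, and then the term is a coefficient of q^m below degree m.
  term : ∀ k → k < suc m → ∀ i → i < suc k → pq i ℤ.* (pq ^ᵖ m) (k ∸ i) ≡ 0ℤ
  term k       _         zero          _        = refl
  term (suc k) (s≤s k<m) (suc zero)    _        = trans (*-identityˡ _) (pq^-coeff-< m k k<m)
  term zero    _         (suc zero)    (s≤s ())
  term k       _         (suc (suc i)) _        = refl

pq^-≈-pq^ : ∀ {r m m′} → r < m → r < m′ → (pq ^ᵖ m) ≈[ r ] (pq ^ᵖ m′)
pq^-≈-pq^ {m = m} {m′} r<m r<m′ k k≤r =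
  trans (pq^-coeff-< m k (≤-<-trans k≤r r<m)) (sym (pq^-coeff-< m′ k (≤-<-trans k≤r r<m′)))

pq^-≈-pq^⊓ : ∀ r t → (pq ^ᵖ t) ≈[ r ] (pq ^ᵖ (t ⊓ suc r))
pq^-≈-pq^⊓ r t with t ≤? suc r
... | yes t≤1+r rewrite m≤n⇒m⊓n≡m t≤1+r = ≈-refl (pq ^ᵖ t)
... | no  t≰1+r rewrite m≥n⇒m⊓n≡n (<⇒≤ (≰⇒> t≰1+r)) = pq^-≈-pq^ (<-trans (n<1+n r) (≰⇒> t≰1+r)) (n<1+n r)

map⁺-diagonal : ∀ {A B : Set} {R : B → B → Set} {f g : A → B} →
  (∀ x → R (f x) (g x)) → ∀ xs → Pointwise R (map f xs) (map g xs)
map⁺-diagonal fx∼gx []       = []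
map⁺-diagonal fx∼gx (x ∷ xs) = fx∼gx x ∷ map⁺-diagonal fx∼gx xs

tabulate-lookup⁺ : ∀ {A B : Set} {R : A → A → Set} {S : B → B → Set} {xs ys} (G : ℕ → A → B) →
  (∀ i {x y} → R x y → S (G i x) (G i y)) → Pointwise R xs ys →
  Pointwise S (tabulate (λ j → G (toℕ j) (lookup xs j))) (tabulate (λ j → G (toℕ j) (lookup ys j)))
tabulate-lookup⁺ G G-cong []             = []
tabulate-lookup⁺ G G-cong (x∼y ∷ xs∼ys) =
  G-cong 0 x∼y ∷ tabulate-lookup⁺ (λ i → G (suc i)) (λ i → G-cong (suc i)) xs∼ys

weightAt-cong : ∀ {r us vs} → Pointwise _≈[ r ]_ us vs → ∀ π → weightAt us π ≈[ r ] weightAt vs π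
weightAt-cong {r} {us} {vs} us≈vs π =
  ⊗-cong (≈-refl (pq ^ᵖ patCount (1 ∷ 2 ∷ 3 ∷ []) π))
    (subst₂ (λ ps qs → pprod ps ≈[ r ] pprod qs) (sym (map-tabulate (λ j → j) (x^cnt us)))
      (sym (map-tabulate (λ j → j) (x^cnt vs)))
      (pprod-cong (tabulate-lookup⁺ (λ i x → x ^ᵖ cnt (suc i) π) (λ i → ^ᵖ-cong (cnt (suc i) π)) us≈vs)))
  where
  x^cnt : (ws : List Poly) → Fin (length ws) → Poly
  x^cnt ws j = lookup ws j ^ᵖ cnt (suc (toℕ j)) π

P-cong : ∀ {r us vs} → Pointwise _≈[ r ]_ us vs → P us ≈[ r ] P vs
P-cong {r} {us} {vs} us≈vs =
  subst (λ n → P us ≈[ r ] psum (map (weightAt vs) (perms n))) (Pointwise-length us≈vs)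
    (psum-cong (map⁺-diagonal (weightAt-cong us≈vs) (perms (length us))))

uList≈vList : ∀ r s (a : Fin (suc s) → ℕ) → Pointwise _≈[ r ]_ (uList s a) (vList r s a)
uList≈vList r s a = Pointwise.concat⁺
  (map⁺-diagonal (λ j → Pointwise.replicate⁺ (pq^-≈-pq^⊓ r (toℕ j)) (a j)) (allFin (suc s)))

mainTheorem2 : (r s : ℕ) → r + 1 < s → (a : Fin (suc s) → ℕ) →
    (k : ℕ) → k ≤ r → coeff (P (uList s a) ⊖ P (vList r s a)) k ≡ 0ℤ
mainTheorem2 r s _ a k k≤r = i≡j⇒i-j≡0 (P-cong (uList≈vList r s a) k k≤r)
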